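{- For $n\ge1$, the number of separable permutations of length $n$ with exactly three occurrences of the 1-box pattern equals the number of separable permutations of length $n-1$ with exactly two occurrences of the 1-box pattern.
   Context: A permutation is separable if it avoids both patterns $2413$ and $3142$, i.e., it has no subsequence of four entries order-isomorphic to $2413$ or to $3142$. For a permutation $\sigma=\sigma_1\cdots\sigma_n$, the number of occurrences of the 1-box pattern is the number of indices $i\in\{1,\dots,n\}$ such that $|\sigma_i-\sigma_{i+1}|=1$ or $|\sigma_{i-1}-\sigma_i|=1$ (conditions involving nonexistent entries $\sigma_0,\sigma_{n+1}$ are ignored). -}

module Defs where

open import Data.Nat using (ℕ; zero; suc; _+_; _∸_; _<_; _≟_)
open import Data.Fin using (Fin; toℕ)
open import Data.Vec using (Vec; lookup)
open import Data.Vec.Relation.Unary.Unique.Propositional using (Unique)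
open import Data.List using (List; length; filter; upTo)
open import Data.Product using (Σ; _×_; ∃)
open import Data.Sum using (_⊎_)
open import Data.Empty using (⊥)
open import Relation.Nullary using (¬_; Dec)
open import Relation.Nullary.Decidable using (_⊎-dec_; _×-dec_)
open import Relation.Binary.PropositionalEquality using (_≡_)

-- A word σ₁⋯σₙ of length n over {0,…,n-1}; a permutation when entries are distinct.
-- (The functions below only read the word; distinctness is imposed in SepBox.)
Word : ℕ → Set
Word n = Vec (Fin n) n

val : ∀ {n} → Word n → Fin n → ℕ
val v i = toℕ (lookup v i)

Occ2413 : ∀ {n} → Word n → Set
Occ2413 {n} σ = Σ (Fin n) λ i → Σ (Fin n) λ j → Σ (Fin n) λ k → Σ (Fin n) λ l →
  (toℕ i < toℕ j) × (toℕ j < toℕ k) × (toℕ k < toℕ l) ×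
  (val σ k < val σ i) × (val σ i < val σ l) × (val σ l < val σ j)

Occ3142 : ∀ {n} → Word n → Set
Occ3142 {n} σ = Σ (Fin n) λ i → Σ (Fin n) λ j → Σ (Fin n) λ k → Σ (Fin n) λ l →
  (toℕ i < toℕ j) × (toℕ j < toℕ k) × (toℕ k < toℕ l) ×
  (val σ j < val σ l) × (val σ l < val σ i) × (val σ i < val σ k)

Separable : ∀ {n} → Word n → Set
Separable σ = ¬ Occ2413 σ × ¬ Occ3142 σ

-- entry at 0-based position p (a natural number), 0 if out of range
valℕ : ∀ {n} → Word n → ℕ → ℕ
valℕ {n} σ p with Data.Nat._<?_ p n
... | Relation.Nullary.yes p<n = val σ (Data.Fin.fromℕ< p<n)
... | Relation.Nullary.no _ = 0

Adj : ℕ → ℕ → Set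
Adj a b = (suc a ≡ b) ⊎ (suc b ≡ a)

adj? : (a b : ℕ) → Dec (Adj a b)
adj? a b = (suc a ≟ b) ⊎-dec (suc b ≟ a)

InBox : ∀ {n} → Word n → ℕ → Set
InBox {n} σ p = ((suc p < n) × Adj (valℕ σ p) (valℕ σ (suc p)))
              ⊎ ((0 < p) × Adj (valℕ σ (p ∸ 1)) (valℕ σ p))

inBox? : ∀ {n} (σ : Word n) (p : ℕ) → Dec (InBox σ p)
inBox? {n} σ p =
  (Data.Nat._<?_ (suc p) n ×-dec adj? (valℕ σ p) (valℕ σ (suc p)))
  ⊎-dec (Data.Nat._<?_ 0 p ×-dec adj? (valℕ σ (p ∸ 1)) (valℕ σ p))

box : ∀ {n} → Word n → ℕ
box {n} σ = length (filter (inBox? σ) (upTo n))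

-- separable permutations of length n with exactly k occurrences of the 1-box pattern
-- The property proofs are irrelevant, so two elements are equal iff their
-- underlying words are equal (this is just the set of such permutations).
record SepBox (n k : ℕ) : Set where
  constructor sepBox
  field
    word      : Vec (Fin n) n
    .unique   : Unique word
    .separable : Separable word
    .boxes    : box word ≡ k

-- The 1-box entries of a permutation are the endpoints of its edges: adjacent positions whose
-- values differ by one. If there are exactly three, the first box a starts an edge (a, a+1) and
-- the third box must be a+2, joined to a+1 (any other edge would bring two new boxes), so the
-- positions a, a+1, a+2 carry a run of three consecutive values. Deleting the middle entry of
-- the run and standardising leaves exactly the two boxes a, a+1. Conversely, the first edge of a
-- permutation with two boxes is blown up into such a run by inserting max(σ a, σ (a+1)) between
-- its ends. Deletion creates no occurrence of 2413 or 3142, and neither does this insertion: the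
-- new entry and its left neighbour are twins (adjacent in position and in value), no occurrence
-- of these patterns contains both twins, and deleting either twin gives the same permutation,
-- so every occurrence survives the deletion.

module Submission where

open import Defs
open import Data.Nat using (ℕ; suc)
open import Function.Bundles using (_⤖_)

open import Data.Empty using (⊥; ⊥-elim)
open import Data.Fin using (Fin; toℕ; fromℕ<)
import Data.Fin.Properties as Fin
open import Data.List using (length; filter; applyUpTo)
open import Data.Nat
  using (zero; _+_; _∸_; _<_; _≤_; z≤n; s≤s; s≤s⁻¹; z<s; s<s; s<s⁻¹; _<?_; _≤?_; _≟_; pred; _⊔_)
open import Data.Nat.Properties
open import Algebra.Properties.CommutativeSemigroup +-commutativeSemigroup using (x∙yz≈y∙xz)
open import Data.Product using (∃; _×_; _,_; proj₁; proj₂)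
open import Data.Sum using (_⊎_; inj₁; inj₂)
import Data.Sum as Sum
open import Data.Sum.Function.Propositional using (_⊎-⇔_)
open import Data.Vec using (lookup; tabulate)
import Data.Vec.Properties as Vec
open import Data.Vec.Relation.Unary.Unique.Propositional using (Unique)
import Data.Vec.Relation.Unary.Unique.Propositional.Properties as Unique
open import Function.Base using (_∘_; case_of_)
open import Function.Bundles using (_⇔_; mk⇔; Equivalence; mk↔ₛ′)
open import Function.Properties.Inverse using (↔⇒⤖)
open import Function.Properties.Equivalence using () renaming (trans to ⇔-trans; sym to ⇔-sym)
open import Relation.Binary.Definitions using (tri<; tri≈; tri>)
open import Relation.Binary.PropositionalEquality
open import Relation.Nullary using (¬_; Dec; yes; no; contradiction)
open import Relation.Nullary.Decidable using (recompute; _×-dec_; _⊎-dec_)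

-- Renumbering

-- ℕ-analogues of Data.Fin.punchIn/punchOut; they renumber positions and values alike.
punchIn : ℕ → ℕ → ℕ
punchIn zero    j       = suc j
punchIn (suc i) zero    = zero
punchIn (suc i) (suc j) = suc (punchIn i j)

punchOut : ℕ → ℕ → ℕ
punchOut zero    j       = pred j
punchOut (suc i) zero    = zero
punchOut (suc i) (suc j) = suc (punchOut i j)

punchIn-< : ∀ {i j} → j < i → punchIn i j ≡ j
punchIn-< {suc i} {zero}  _          = refl
punchIn-< {suc i} {suc j} (s<s j<i) = cong suc (punchIn-< j<i)

punchIn-≥ : ∀ {i j} → i ≤ j → punchIn i j ≡ suc j
punchIn-≥ {zero}          _          = refl
punchIn-≥ {suc i} {suc j} (s≤s i≤j) = cong suc (punchIn-≥ i≤j)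

punchOut-< : ∀ {i j} → j < i → punchOut i j ≡ j
punchOut-< {suc i} {zero}  _          = refl
punchOut-< {suc i} {suc j} (s<s j<i) = cong suc (punchOut-< j<i)

punchOut-> : ∀ {i j} → i < j → punchOut i j ≡ pred j
punchOut-> {zero}                 _          = refl
punchOut-> {suc i} {suc (suc j)} (s<s i<j) = cong suc (punchOut-> i<j)

punchIn≢ : ∀ i j → punchIn i j ≢ i
punchIn≢ zero    j       ()
punchIn≢ (suc i) zero    ()
punchIn≢ (suc i) (suc j) eq = punchIn≢ i j (suc-injective eq)

punchIn-suc : ∀ {i j} → suc j ≢ i → punchIn i (suc j) ≡ suc (punchIn i j)
punchIn-suc {zero}                _  = refl
punchIn-suc {suc zero}    {zero}  ne = contradiction refl ne
punchIn-suc {suc (suc i)} {zero}  _  = refl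
punchIn-suc {suc i}       {suc j} ne = cong suc (punchIn-suc (ne ∘ cong suc))

punchIn-injective : ∀ i {j k} → punchIn i j ≡ punchIn i k → j ≡ k
punchIn-injective zero    eq = suc-injective eq
punchIn-injective (suc i) {zero}  {zero}  _  = refl
punchIn-injective (suc i) {suc j} {suc k} eq = cong suc (punchIn-injective i (suc-injective eq))

punchIn-mono-< : ∀ i {j k} → j < k → punchIn i j < punchIn i k
punchIn-mono-< zero    j<k = s<s j<k
punchIn-mono-< (suc i) {zero}  {suc k} _          = z<s
punchIn-mono-< (suc i) {suc j} {suc k} (s<s j<k) = s<s (punchIn-mono-< i j<k)

punchIn-cancel-< : ∀ i {j k} → punchIn i j < punchIn i k → j < k
punchIn-cancel-< zero    (s<s lt) = lt
punchIn-cancel-< (suc i) {zero}  {suc k} _         = z<s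
punchIn-cancel-< (suc i) {suc j} {suc k} (s<s lt) = s<s (punchIn-cancel-< i lt)

punchIn<suc : ∀ i {j n} → j < n → punchIn i j < suc n
punchIn<suc zero    j<n = s<s j<n
punchIn<suc (suc i) {zero}  {suc n} _          = z<s
punchIn<suc (suc i) {suc j} {suc n} (s<s j<n) = s<s (punchIn<suc i j<n)

punchIn<suc⁻ : ∀ {i j n} → i ≤ n → punchIn i j < suc n → j < n
punchIn<suc⁻ {i} {j} i≤n lt with j <? i
... | yes j<i = <-≤-trans j<i i≤n
... | no j≮i  = s<s⁻¹ (subst (_< _) (punchIn-≥ (≮⇒≥ j≮i)) lt)

punchOut-punchIn : ∀ i j → punchOut i (punchIn i j) ≡ j
punchOut-punchIn zero    j       = refl
punchOut-punchIn (suc i) zero    = refl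
punchOut-punchIn (suc i) (suc j) = cong suc (punchOut-punchIn i j)

punchIn-punchOut : ∀ {i j} → j ≢ i → punchIn i (punchOut i j) ≡ j
punchIn-punchOut {zero}  {zero}  ne = contradiction refl ne
punchIn-punchOut {zero}  {suc j} _  = refl
punchIn-punchOut {suc i} {zero}  _  = refl
punchIn-punchOut {suc i} {suc j} ne = cong suc (punchIn-punchOut (ne ∘ cong suc))

punchOut< : ∀ {i j n} → i ≤ n → j ≢ i → j < suc n → punchOut i j < n
punchOut< {i} {j} i≤n j≢i j<1+n =
  punchIn<suc⁻ i≤n (subst (_< _) (sym (punchIn-punchOut j≢i)) j<1+n)

punchOut-injective : ∀ {i j k} → j ≢ i → k ≢ i → punchOut i j ≡ punchOut i k → j ≡ k
punchOut-injective {i} j≢i k≢i eq =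
  trans (sym (punchIn-punchOut j≢i)) (trans (cong (punchIn i) eq) (punchIn-punchOut k≢i))

punchOut-mono-< : ∀ {i j k} → j ≢ i → k ≢ i → j < k → punchOut i j < punchOut i k
punchOut-mono-< {i} j≢i k≢i j<k =
  punchIn-cancel-< i (subst₂ _<_ (sym (punchIn-punchOut j≢i)) (sym (punchIn-punchOut k≢i)) j<k)

punchOut-cancel-< : ∀ {i j k} → j ≢ i → k ≢ i → punchOut i j < punchOut i k → j < k
punchOut-cancel-< {i} j≢i k≢i lt =
  subst₂ _<_ (punchIn-punchOut j≢i) (punchIn-punchOut k≢i) (punchIn-mono-< i lt)

Adj-sym : ∀ {a b} → Adj a b → Adj b a
Adj-sym (inj₁ eq) = inj₂ eq
Adj-sym (inj₂ eq) = inj₁ eq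

Adj-pred : ∀ {a b} → 0 < a → 0 < b → Adj (pred a) (pred b) → Adj a b
Adj-pred {suc a} {suc b} _ _ (inj₁ eq) = inj₁ (cong suc eq)
Adj-pred {suc a} {suc b} _ _ (inj₂ eq) = inj₂ (cong suc eq)

Adj-pred-self : ∀ {a} → 0 < a → Adj (pred a) a
Adj-pred-self {suc a} _ = inj₁ refl

punchOut-Adj-suc : ∀ {m a} → a ≢ m → suc a ≢ m → Adj (punchOut m a) (punchOut m (suc a))
punchOut-Adj-suc {m} {a} a≢m 1+a≢m with <-cmp a m
... | tri< a<m _ _ = subst₂ Adj (sym (punchOut-< a<m)) (sym (punchOut-< (≤∧≢⇒< a<m 1+a≢m))) (inj₁ refl)
... | tri≈ _ a≡m _ = contradiction a≡m a≢m
... | tri> _ _ m<a =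
  subst₂ Adj (sym (punchOut-> m<a)) (sym (punchOut-> (m<n⇒m<1+n m<a))) (Adj-pred-self (≤-<-trans z≤n m<a))

Adj-punchOut⁺ : ∀ {m a b} → a ≢ m → b ≢ m → Adj a b → Adj (punchOut m a) (punchOut m b)
Adj-punchOut⁺ a≢m b≢m (inj₁ refl) = punchOut-Adj-suc a≢m b≢m
Adj-punchOut⁺ a≢m b≢m (inj₂ refl) = Adj-sym (punchOut-Adj-suc b≢m a≢m)

Adj-straddle : ∀ {m a b} → a < m → m < b → Adj a (pred b) → Adj a m × Adj m b
Adj-straddle {m} {a} {suc b} a<m (s≤s m≤b) (inj₁ 1+a≡b) =
  inj₁ (sym m≡1+a) , inj₁ (cong suc (trans m≡1+a 1+a≡b))
  where
  m≡1+a : m ≡ suc a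
  m≡1+a = ≤-antisym (≤-trans m≤b (≤-reflexive (sym 1+a≡b))) a<m
Adj-straddle {m} {a} {suc b} a<m m<1+b (inj₂ 1+b≡a) = contradiction (subst (m <_) 1+b≡a m<1+b) (<-asym a<m)

Adj-punchOut⁻ : ∀ {m a b} → a ≢ m → b ≢ m → ¬ (Adj a m × Adj m b) →
                Adj (punchOut m a) (punchOut m b) → Adj a b
Adj-punchOut⁻ {m} {a} {b} a≢m b≢m no-straddle adj with <-cmp a m | <-cmp b m
... | tri≈ _ a≡m _ | _            = contradiction a≡m a≢m
... | _            | tri≈ _ b≡m _ = contradiction b≡m b≢m
... | tri< a<m _ _ | tri< b<m _ _ = subst₂ Adj (punchOut-< a<m) (punchOut-< b<m) adj
... | tri> _ _ m<a | tri> _ _ m<b =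
  Adj-pred (≤-<-trans z≤n m<a) (≤-<-trans z≤n m<b) (subst₂ Adj (punchOut-> m<a) (punchOut-> m<b) adj)
... | tri< a<m _ _ | tri> _ _ m<b =
  contradiction (Adj-straddle a<m m<b (subst₂ Adj (punchOut-< a<m) (punchOut-> m<b) adj)) no-straddle
... | tri> _ _ m<a | tri< b<m _ _
  with Adj-straddle b<m m<a (Adj-sym (subst₂ Adj (punchOut-> m<a) (punchOut-< b<m) adj))
...   | b~m , m~a = contradiction (Adj-sym m~a , Adj-sym b~m) no-straddle

punchOut-Adj-comm : ∀ {a b} → Adj a b → punchOut a b ≡ punchOut b a
punchOut-Adj-comm {a} (inj₁ refl) = trans (punchOut-> (n<1+n a)) (sym (punchOut-< (n<1+n a)))
punchOut-Adj-comm {b = b} (inj₂ refl) = trans (punchOut-< (n<1+n b)) (sym (punchOut-> (n<1+n b)))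

punchOut-Adj-cong : ∀ {a b v} → Adj a b → v ≢ a → v ≢ b → punchOut a v ≡ punchOut b v
punchOut-Adj-cong {a} {v = v} (inj₁ refl) v≢a v≢1+a with <-cmp v a
... | tri< v<a _ _ = trans (punchOut-< v<a) (sym (punchOut-< (m<n⇒m<1+n v<a)))
... | tri≈ _ v≡a _ = contradiction v≡a v≢a
... | tri> _ _ a<v = trans (punchOut-> a<v) (sym (punchOut-> (≤∧≢⇒< a<v (≢-sym v≢1+a))))
punchOut-Adj-cong (inj₂ refl) v≢a v≢b = sym (punchOut-Adj-cong (inj₁ refl) v≢b v≢a)

punchIn-twins : ∀ {i j} → j ≢ i → punchIn i j ≡ punchIn (suc i) j
punchIn-twins {i} {j} j≢i with <-cmp j i
... | tri< j<i _ _ = trans (punchIn-< j<i) (sym (punchIn-< (m<n⇒m<1+n j<i)))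
... | tri≈ _ j≡i _ = contradiction j≡i j≢i
... | tri> _ _ i<j = trans (punchIn-≥ (<⇒≤ i<j)) (sym (punchIn-≥ i<j))

-- Counting

indicator : ∀ {P : Set} → Dec P → ℕ
indicator (yes _) = 1
indicator (no _)  = 0

count : ∀ {P : ℕ → Set} → (∀ p → Dec (P p)) → ℕ → ℕ
count P? zero    = 0
count P? (suc n) = indicator (P? 0) + count (λ p → P? (suc p)) n

length-filter-applyUpTo : ∀ {P : ℕ → Set} (P? : ∀ p → Dec (P p)) f n →
                          length (filter P? (applyUpTo f n)) ≡ count (λ p → P? (f p)) n
length-filter-applyUpTo P? f zero = refl
length-filter-applyUpTo P? f (suc n) with P? (f 0)
... | yes _ = cong suc (length-filter-applyUpTo P? (f ∘ suc) n)
... | no _  = length-filter-applyUpTo P? (f ∘ suc) n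

indicator-yes : ∀ {P : Set} (P? : Dec P) → P → indicator P? ≡ 1
indicator-yes (yes _) _  = refl
indicator-yes (no ¬p) p = contradiction p ¬p

indicator-cong : ∀ {P Q : Set} (P? : Dec P) (Q? : Dec Q) → P ⇔ Q → indicator P? ≡ indicator Q?
indicator-cong (yes _) (yes _) _    = refl
indicator-cong (yes p) (no ¬q) P⇔Q = contradiction (Equivalence.to P⇔Q p) ¬q
indicator-cong (no ¬p) (yes q) P⇔Q = contradiction (Equivalence.from P⇔Q q) ¬p
indicator-cong (no _)  (no _)  _    = refl

count-cong : ∀ {P Q : ℕ → Set} (P? : ∀ p → Dec (P p)) (Q? : ∀ p → Dec (Q p)) n →
             (∀ p → p < n → P p ⇔ Q p) → count P? n ≡ count Q? n
count-cong P? Q? zero    _   = refl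
count-cong P? Q? (suc n) P⇔Q =
  cong₂ _+_ (indicator-cong (P? 0) (Q? 0) (P⇔Q 0 z<s))
            (count-cong (λ p → P? (suc p)) (λ p → Q? (suc p)) n (λ p p<n → P⇔Q (suc p) (s<s p<n)))

count-none : ∀ {P : ℕ → Set} (P? : ∀ p → Dec (P p)) n → (∀ p → p < n → ¬ P p) → count P? n ≡ 0
count-none P? zero    _    = refl
count-none P? (suc n) none with P? 0
... | yes p0 = contradiction p0 (none 0 z<s)
... | no _   = count-none (λ p → P? (suc p)) n (λ p p<n → none (suc p) (s<s p<n))

count-punchIn : ∀ {P : ℕ → Set} (P? : ∀ p → Dec (P p)) q n → q ≤ n →
                count P? (suc n) ≡ indicator (P? q) + count (λ p → P? (punchIn q p)) n
count-punchIn P? zero    n       _          = refl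
count-punchIn P? (suc q) (suc n) (s≤s q≤n) = begin
  indicator (P? 0) + count (λ p → P? (suc p)) (suc n)
    ≡⟨ cong (indicator (P? 0) +_) (count-punchIn (λ p → P? (suc p)) q n q≤n) ⟩
  indicator (P? 0) + (indicator (P? (suc q)) + count (λ p → P? (suc (punchIn q p))) n)
    ≡⟨ x∙yz≈y∙xz (indicator (P? 0)) (indicator (P? (suc q))) _ ⟩
  indicator (P? (suc q)) + (indicator (P? 0) + count (λ p → P? (suc (punchIn q p))) n) ∎
  where open ≡-Reasoning

count-pos : ∀ {P : ℕ → Set} (P? : ∀ p → Dec (P p)) {x n} → P x → x < n → 0 < count P? n
count-pos P? {x} {suc n} px (s≤s x≤n) rewrite count-punchIn P? x n x≤n | indicator-yes (P? x) px = z<s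

count-two : ∀ {P : ℕ → Set} (P? : ∀ p → Dec (P p)) {x y n} → P x → P y → x < y → y < n → 1 < count P? n
count-two {P} P? {x} {suc y} {suc n} px py x<1+y (s≤s y<n)
  rewrite count-punchIn P? x n (≤-trans (s≤s⁻¹ x<1+y) (<⇒≤ y<n)) | indicator-yes (P? x) px =
  s<s (count-pos (λ p → P? (punchIn x p)) (subst P (sym (punchIn-≥ (s≤s⁻¹ x<1+y))) py) y<n)

Least : (ℕ → Set) → ℕ → ℕ → Set
Least P n a = a < n × P a × (∀ p → p < a → ¬ P p)

Least-unique : ∀ {P : ℕ → Set} {n m a b} → Least P n a → Least P m b → a ≡ b
Least-unique {a = a} {b} (_ , pa , below-a) (_ , pb , below-b) with <-cmp a b
... | tri< a<b _ _ = contradiction pa (below-b a a<b)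
... | tri≈ _ a≡b _ = a≡b
... | tri> _ _ b<a = contradiction pb (below-a b b<a)

least? : ∀ {P : ℕ → Set} (P? : ∀ p → Dec (P p)) n → (∀ p → p < n → ¬ P p) ⊎ ∃ (Least P n)
least? P? zero = inj₁ (λ _ ())
least? P? (suc n) with least? P? n
... | inj₂ (a , a<n , pa , below) = inj₂ (a , m<n⇒m<1+n a<n , pa , below)
... | inj₁ none with P? n
...   | yes pn = inj₂ (n , n<1+n n , pn , none)
...   | no ¬pn = inj₁ λ p p<1+n → case m<1+n⇒m<n∨m≡n p<1+n of λ where
          (inj₁ p<n)  → none p p<n
          (inj₂ refl) → ¬pn

least-exists : ∀ {P : ℕ → Set} (P? : ∀ p → Dec (P p)) n → count P? n ≢ 0 → ∃ (Least P n)
least-exists P? n count≢0 with least? P? n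
... | inj₁ none  = contradiction (count-none P? n none) count≢0
... | inj₂ least = least

-- Boxes

-- Permutations of length n are handled as functions ℕ → ℕ of which only the values below n matter.
infix 4 _≈[_]_
_≈[_]_ : (ℕ → ℕ) → ℕ → (ℕ → ℕ) → Set
f ≈[ n ] g = ∀ {p} → p < n → f p ≡ g p

≈-sym : ∀ {f g n} → f ≈[ n ] g → g ≈[ n ] f
≈-sym f≈g p<n = sym (f≈g p<n)

≈-trans : ∀ {f g h n} → f ≈[ n ] g → g ≈[ n ] h → f ≈[ n ] h
≈-trans f≈g g≈h p<n = trans (f≈g p<n) (g≈h p<n)

Edge : ℕ → (ℕ → ℕ) → ℕ → Set
Edge n f p = suc p < n × Adj (f p) (f (suc p))

-- Defs.InBox read on a function: boxAt? n (valℕ σ) is inBox? σ definitionally.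
BoxAt : ℕ → (ℕ → ℕ) → ℕ → Set
BoxAt n f p = Edge n f p ⊎ (0 < p × Adj (f (p ∸ 1)) (f p))

boxAt? : ∀ n f p → Dec (BoxAt n f p)
boxAt? n f p = (suc p <? n ×-dec adj? (f p) (f (suc p))) ⊎-dec (0 <? p ×-dec adj? (f (p ∸ 1)) (f p))

box≡count : ∀ {n} (σ : Word n) → box σ ≡ count (boxAt? n (valℕ σ)) n
box≡count {n} σ = length-filter-applyUpTo (boxAt? n (valℕ σ)) (λ p → p) n

boxAt-zero : ∀ {n f} → BoxAt n f 0 ⇔ Edge n f 0
boxAt-zero = mk⇔ (λ { (inj₁ e) → e ; (inj₂ (() , _)) }) inj₁

boxAt-suc : ∀ {n f p} → suc p < n → BoxAt n f (suc p) ⇔ (Edge n f (suc p) ⊎ Edge n f p)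
boxAt-suc 1+p<n = mk⇔ (Sum.map₂ λ (_ , adj) → 1+p<n , adj) (Sum.map₂ λ (_ , adj) → z<s , adj)

boxAt-transport : ∀ {n f g p} → f ≈[ n ] g → p < n → BoxAt n f p → BoxAt n g p
boxAt-transport f≈g p<n (inj₁ (1+p<n , adj)) = inj₁ (1+p<n , subst₂ Adj (f≈g p<n) (f≈g 1+p<n) adj)
boxAt-transport {p = suc p} f≈g 1+p<n (inj₂ (_ , adj)) =
  inj₂ (z<s , subst₂ Adj (f≈g (<-trans (n<1+n p) 1+p<n)) (f≈g 1+p<n) adj)

boxAt-cong : ∀ {n f g p} → f ≈[ n ] g → p < n → BoxAt n f p ⇔ BoxAt n g p
boxAt-cong f≈g p<n = mk⇔ (boxAt-transport f≈g p<n) (boxAt-transport (≈-sym f≈g) p<n)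

boxCount-cong : ∀ {n f g} → f ≈[ n ] g → count (boxAt? n f) n ≡ count (boxAt? n g) n
boxCount-cong {n} {f} {g} f≈g = count-cong (boxAt? n f) (boxAt? n g) n (λ p p<n → boxAt-cong f≈g p<n)

Least-boxAt-cong : ∀ {n f g a} → f ≈[ n ] g → Least (BoxAt n f) n a → Least (BoxAt n g) n a
Least-boxAt-cong f≈g (a<n , box-a , below) =
  a<n , boxAt-transport f≈g a<n box-a ,
  λ p p<a box-p → below p p<a (boxAt-transport (≈-sym f≈g) (<-trans p<a a<n) box-p)

least-edge : ∀ {n f a} → Least (BoxAt n f) n a → Edge n f a
least-edge (_ , inj₁ edge , _) = edge
least-edge {a = suc a} (1+a<n , inj₂ (_ , adj) , below) = contradiction (inj₁ (1+a<n , adj)) (below a (n<1+n a))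

firstBox : ℕ → (ℕ → ℕ) → ℕ
firstBox n f with least? (boxAt? n f) n
... | inj₁ _       = 0
... | inj₂ (a , _) = a

firstBox-spec : ∀ {n f a} → Least (BoxAt n f) n a → firstBox n f ≡ a
firstBox-spec {n} {f} least-a with least? (boxAt? n f) n
... | inj₁ none          = contradiction (proj₁ (proj₂ least-a)) (none _ (proj₁ least-a))
... | inj₂ (b , least-b) = Least-unique least-b least-a

-- Words as functions

InjectiveBelow : ℕ → (ℕ → ℕ) → Set
InjectiveBelow n f = ∀ {x y} → x < n → y < n → f x ≡ f y → x ≡ y

BoundedBelow : ℕ → (ℕ → ℕ) → Set
BoundedBelow n f = ∀ {x} → x < n → f x < n

valℕ-fromℕ< : ∀ {n} (σ : Word n) {p} (p<n : p < n) → valℕ σ p ≡ val σ (fromℕ< p<n)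
valℕ-fromℕ< {n} σ {p} p<n with p <? n
... | yes _  = refl
... | no p≮n = contradiction p<n p≮n

valℕ-toℕ : ∀ {n} (σ : Word n) i → valℕ σ (toℕ i) ≡ val σ i
valℕ-toℕ σ i = trans (valℕ-fromℕ< σ (Fin.toℕ<n i)) (cong (val σ) (Fin.fromℕ<-toℕ i _))

valℕ-bounded : ∀ {n} (σ : Word n) → BoundedBelow n (valℕ σ)
valℕ-bounded σ p<n = subst (_< _) (sym (valℕ-fromℕ< σ p<n)) (Fin.toℕ<n _)

valℕ-injective : ∀ {n} {σ : Word n} → Unique σ → InjectiveBelow n (valℕ σ)
valℕ-injective {σ = σ} σ! {x} {y} x<n y<n eq = begin
  x                     ≡⟨ Fin.toℕ-fromℕ< x<n ⟨
  toℕ (fromℕ< x<n)      ≡⟨ cong toℕ (Unique.lookup-injective σ! _ _ (Fin.toℕ-injective lookups≡)) ⟩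
  toℕ (fromℕ< y<n)      ≡⟨ Fin.toℕ-fromℕ< y<n ⟩
  y                     ∎
  where
  open ≡-Reasoning
  lookups≡ : val σ (fromℕ< x<n) ≡ val σ (fromℕ< y<n)
  lookups≡ = trans (sym (valℕ-fromℕ< σ x<n)) (trans eq (valℕ-fromℕ< σ y<n))

word-≡ : ∀ {n} {σ τ : Word n} → valℕ σ ≈[ n ] valℕ τ → σ ≡ τ
word-≡ {σ = σ} {τ} σ≈τ = begin
  σ                      ≡⟨ Vec.tabulate∘lookup σ ⟨
  tabulate (lookup σ)    ≡⟨ Vec.tabulate-cong (λ i → Fin.toℕ-injective (lookup≡ i)) ⟩
  tabulate (lookup τ)    ≡⟨ Vec.tabulate∘lookup τ ⟩
  τ                      ∎
  where
  open ≡-Reasoning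
  lookup≡ : ∀ i → val σ i ≡ val τ i
  lookup≡ i = trans (sym (valℕ-toℕ σ i)) (trans (σ≈τ (Fin.toℕ<n i)) (valℕ-toℕ τ i))

toWord : ∀ n f → .(BoundedBelow n f) → Word n
toWord n f f<n = tabulate λ i → fromℕ< (f<n (Fin.toℕ<n i))

toℕ-fromℕ<-bounded : ∀ n f .(f<n : BoundedBelow n f) i → toℕ (fromℕ< (f<n (Fin.toℕ<n i))) ≡ f (toℕ i)
toℕ-fromℕ<-bounded n f f<n i = Fin.toℕ-fromℕ< (recompute (f (toℕ i) <? n) (f<n (Fin.toℕ<n i)))

valℕ-toWord : ∀ n f .(f<n : BoundedBelow n f) → valℕ (toWord n f f<n) ≈[ n ] f
valℕ-toWord n f f<n {p} p<n = begin
  valℕ (toWord n f f<n) p                  ≡⟨ valℕ-fromℕ< (toWord n f f<n) p<n ⟩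
  toℕ (lookup (toWord n f f<n) (fromℕ< p<n)) ≡⟨ cong toℕ (Vec.lookup∘tabulate _ (fromℕ< p<n)) ⟩
  toℕ (fromℕ< (f<n (Fin.toℕ<n _)))         ≡⟨ toℕ-fromℕ<-bounded n f f<n _ ⟩
  f (toℕ (fromℕ< p<n))                      ≡⟨ cong f (Fin.toℕ-fromℕ< p<n) ⟩
  f p                                       ∎
  where open ≡-Reasoning

toWord-unique : ∀ n f .(f<n : BoundedBelow n f) → InjectiveBelow n f → Unique (toWord n f f<n)
toWord-unique n f f<n f-inj = Unique.tabulate⁺ λ {i} {j} eq → Fin.toℕ-injective
  (f-inj (Fin.toℕ<n i) (Fin.toℕ<n j)
     (trans (sym (toℕ-fromℕ<-bounded n f f<n i)) (trans (cong toℕ eq) (toℕ-fromℕ<-bounded n f f<n j))))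

-- The patterns 2413 and 3142

data Pattern : Set where
  p2413 p3142 : Pattern

-- An occurrence at positions i < j < k < l has values f k ⊏ f i ⊏ f l ⊏ f j:
-- 3142 is 2413 with the value order reversed.
infix 4 _⊏[_]_
_⊏[_]_ : ℕ → Pattern → ℕ → Set
x ⊏[ p2413 ] y = x < y
x ⊏[ p3142 ] y = y < x

record Occ (π : Pattern) (n : ℕ) (f : ℕ → ℕ) : Set where
  constructor occ
  field
    i j k l : ℕ
    i<j : i < j
    j<k : j < k
    k<l : k < l
    l<n : l < n
    ki : f k ⊏[ π ] f i
    il : f i ⊏[ π ] f l
    lj : f l ⊏[ π ] f j

  k<n : k < n
  k<n = <-trans k<l l<n

  j<n : j < n
  j<n = <-trans j<k k<n

  i<n : i < n
  i<n = <-trans i<j j<n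

module _ {n} (σ : Word n) where
  private
    fin-< : ∀ {x y} (x<n : x < n) (y<n : y < n) → x < y → toℕ (fromℕ< x<n) < toℕ (fromℕ< y<n)
    fin-< x<n y<n = subst₂ _<_ (sym (Fin.toℕ-fromℕ< x<n)) (sym (Fin.toℕ-fromℕ< y<n))

    val-< : ∀ {x y} (x<n : x < n) (y<n : y < n) → valℕ σ x < valℕ σ y → val σ (fromℕ< x<n) < val σ (fromℕ< y<n)
    val-< x<n y<n = subst₂ _<_ (valℕ-fromℕ< σ x<n) (valℕ-fromℕ< σ y<n)

    valℕ-< : ∀ {x y} → val σ x < val σ y → valℕ σ (toℕ x) < valℕ σ (toℕ y)
    valℕ-< {x} {y} = subst₂ _<_ (sym (valℕ-toℕ σ x)) (sym (valℕ-toℕ σ y))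

  separable⇒occFree : Separable σ → ∀ π → ¬ Occ π n (valℕ σ)
  separable⇒occFree (¬2413 , _) p2413 o@(occ _ _ _ _ i<j j<k k<l l<n ki il lj) =
    ¬2413 (_ , _ , _ , _ , fin-< i<n j<n i<j , fin-< j<n k<n j<k , fin-< k<n l<n k<l ,
           val-< k<n i<n ki , val-< i<n l<n il , val-< l<n j<n lj)
    where open Occ o using (i<n; j<n; k<n)
  separable⇒occFree (_ , ¬3142) p3142 o@(occ _ _ _ _ i<j j<k k<l l<n ki il lj) =
    ¬3142 (_ , _ , _ , _ , fin-< i<n j<n i<j , fin-< j<n k<n j<k , fin-< k<n l<n k<l ,
           val-< j<n l<n lj , val-< l<n i<n il , val-< i<n k<n ki)
    where open Occ o using (i<n; j<n; k<n)

  occFree⇒separable : (∀ π → ¬ Occ π n (valℕ σ)) → Separable σ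
  occFree⇒separable occ-free =
      (λ (i , j , k , l , i<j , j<k , k<l , ki , il , lj) →
         occ-free p2413 (occ _ _ _ _ i<j j<k k<l (Fin.toℕ<n l) (valℕ-< ki) (valℕ-< il) (valℕ-< lj)))
    , (λ (i , j , k , l , i<j , j<k , k<l , jl , li , ik) →
         occ-free p3142 (occ _ _ _ _ i<j j<k k<l (Fin.toℕ<n l) (valℕ-< ik) (valℕ-< li) (valℕ-< jl)))

⊏-trans : ∀ π {a b c} → a ⊏[ π ] b → b ⊏[ π ] c → a ⊏[ π ] c
⊏-trans p2413 a<b b<c = <-trans a<b b<c
⊏-trans p3142 b<a c<b = <-trans c<b b<a

⊏-punchOut : ∀ π {m a b} → a ≢ m → b ≢ m → a ⊏[ π ] b → punchOut m a ⊏[ π ] punchOut m b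
⊏-punchOut p2413 a≢m b≢m = punchOut-mono-< a≢m b≢m
⊏-punchOut p3142 a≢m b≢m = punchOut-mono-< b≢m a≢m

⊏-punchOut⁻ : ∀ π {m a b} → a ≢ m → b ≢ m → punchOut m a ⊏[ π ] punchOut m b → a ⊏[ π ] b
⊏-punchOut⁻ p2413 a≢m b≢m = punchOut-cancel-< a≢m b≢m
⊏-punchOut⁻ p3142 a≢m b≢m = punchOut-cancel-< b≢m a≢m

<-between⇒¬Adj : ∀ {a b c} → a < b → b < c → ¬ Adj a c
<-between⇒¬Adj a<b b<c (inj₁ refl) = <⇒≱ b<c a<b
<-between⇒¬Adj a<b b<c (inj₂ refl) = <-asym (<-trans a<b b<c) (n<1+n _)

⊏-between⇒¬Adj : ∀ π {a b c} → a ⊏[ π ] b → b ⊏[ π ] c → ¬ Adj a c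
⊏-between⇒¬Adj p2413 a<b b<c = <-between⇒¬Adj a<b b<c
⊏-between⇒¬Adj p3142 b<a c<b = <-between⇒¬Adj c<b b<a ∘ Adj-sym

Occ-cong : ∀ {π n f g} → f ≈[ n ] g → Occ π n f → Occ π n g
Occ-cong {π} {n} {f} {g} f≈g o@(occ i j k l i<j j<k k<l l<n ki il lj) =
  occ i j k l i<j j<k k<l l<n (⊏-cong k<n i<n ki) (⊏-cong i<n l<n il) (⊏-cong l<n j<n lj)
  where
  open Occ o using (i<n; j<n; k<n)
  ⊏-cong : ∀ {x y} → x < n → y < n → f x ⊏[ π ] f y → g x ⊏[ π ] g y
  ⊏-cong x<n y<n = subst₂ (λ a b → a ⊏[ π ] b) (f≈g x<n) (f≈g y<n)

Avoids : ∀ {π n f} → Occ π n f → ℕ → Set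
Avoids o x = Occ.i o ≢ x × Occ.j o ≢ x × Occ.k o ≢ x × Occ.l o ≢ x

-- In 2413 and 3142, a third entry lies in value between any two positionally consecutive ones.
twin-free : ∀ {π n f x} → Adj (f x) (f (suc x)) → (o : Occ π n f) → Avoids o x ⊎ Avoids o (suc x)
twin-free {π} {f = f} {x} adj (occ i j k l i<j j<k k<l _ ki il lj) with i ≟ x | j ≟ x | k ≟ x | l ≟ x
... | yes refl | _ | _ | _ =
  inj₂ ( <⇒≢ (n<1+n i)
       , (λ { refl → ⊏-between⇒¬Adj π il lj adj })
       , >⇒≢ (≤-<-trans i<j j<k)
       , >⇒≢ (≤-<-trans i<j (<-trans j<k k<l)))
... | _ | yes refl | _ | _ =
  inj₂ ( <⇒≢ (<-trans i<j (n<1+n j))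
       , <⇒≢ (n<1+n j)
       , (λ { refl → ⊏-between⇒¬Adj π ki (⊏-trans π il lj) (Adj-sym adj) })
       , >⇒≢ (≤-<-trans j<k k<l))
... | _ | _ | yes refl | _ =
  inj₂ ( <⇒≢ (<-trans (<-trans i<j j<k) (n<1+n k))
       , <⇒≢ (<-trans j<k (n<1+n k))
       , <⇒≢ (n<1+n k)
       , (λ { refl → ⊏-between⇒¬Adj π ki il adj }))
... | _ | _ | _ | yes refl =
  inj₂ ( <⇒≢ (<-trans (<-trans i<j (<-trans j<k k<l)) (n<1+n l))
       , <⇒≢ (<-trans (<-trans j<k k<l) (n<1+n l))
       , <⇒≢ (<-trans k<l (n<1+n l))
       , <⇒≢ (n<1+n l))
... | no i≢x | no j≢x | no k≢x | no l≢x = inj₁ (i≢x , j≢x , k≢x , l≢x)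

-- Deleting and inserting an entry

delete : ℕ → (ℕ → ℕ) → ℕ → ℕ
delete q F i = punchOut (F q) (F (punchIn q i))

insertAt : ℕ → ℕ → (ℕ → ℕ) → ℕ → ℕ
insertAt zero    x g zero    = x
insertAt zero    x g (suc i) = g i
insertAt (suc q) x g zero    = g 0
insertAt (suc q) x g (suc i) = insertAt q x (g ∘ suc) i

insert : ℕ → ℕ → (ℕ → ℕ) → ℕ → ℕ
insert q m f = insertAt q m (punchIn m ∘ f)

insertAt-at : ∀ q x g → insertAt q x g q ≡ x
insertAt-at zero    x g = refl
insertAt-at (suc q) x g = insertAt-at q x (g ∘ suc)

insertAt-punchIn : ∀ q x g i → insertAt q x g (punchIn q i) ≡ g i
insertAt-punchIn zero    x g i       = refl
insertAt-punchIn (suc q) x g zero    = refl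
insertAt-punchIn (suc q) x g (suc i) = insertAt-punchIn q x (g ∘ suc) i

insert-at : ∀ q m f → insert q m f q ≡ m
insert-at q m f = insertAt-at q m (punchIn m ∘ f)

insert-punchIn : ∀ q m f i → insert q m f (punchIn q i) ≡ punchIn m (f i)
insert-punchIn q m f = insertAt-punchIn q m (punchIn m ∘ f)

insert-≢ : ∀ {q m f j} → j ≢ q → insert q m f j ≡ punchIn m (f (punchOut q j))
insert-≢ {q} {m} {f} {j} j≢q =
  trans (cong (insert q m f) (sym (punchIn-punchOut j≢q))) (insert-punchIn q m f (punchOut q j))

delete-insert : ∀ q m f i → delete q (insert q m f) i ≡ f i
delete-insert q m f i =
  trans (cong₂ punchOut (insert-at q m f) (insert-punchIn q m f i)) (punchOut-punchIn m (f i))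

insert-bounded : ∀ {n f q m} → BoundedBelow n f → q ≤ n → m ≤ n → BoundedBelow (suc n) (insert q m f)
insert-bounded {n} {f} {q} {m} f< q≤n m≤n {j} j<1+n with j ≟ q
... | yes refl = subst (_< suc n) (sym (insert-at q m f)) (s≤s m≤n)
... | no j≢q   = subst (_< suc n) (sym (insert-≢ j≢q)) (punchIn<suc m (f< (punchOut< q≤n j≢q j<1+n)))

insert-injective : ∀ {n f q m} → InjectiveBelow n f → q ≤ n → InjectiveBelow (suc n) (insert q m f)
insert-injective {n} {f} {q} {m} f-inj q≤n {j} {j′} j<1+n j′<1+n eq with j ≟ q | j′ ≟ q
... | yes j≡q | yes j′≡q = trans j≡q (sym j′≡q)
... | yes refl | no j′≢q =
  contradiction (trans (sym (insert-≢ j′≢q)) (trans (sym eq) (insert-at q m f))) (punchIn≢ m _)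
... | no j≢q | yes refl =
  contradiction (trans (sym (insert-≢ j≢q)) (trans eq (insert-at q m f))) (punchIn≢ m _)
... | no j≢q | no j′≢q = punchOut-injective j≢q j′≢q
  (f-inj (punchOut< q≤n j≢q j<1+n) (punchOut< q≤n j′≢q j′<1+n)
         (punchIn-injective m (trans (sym (insert-≢ j≢q)) (trans eq (insert-≢ j′≢q)))))

insert-cong : ∀ {n f g q m} → f ≈[ n ] g → q ≤ n → insert q m f ≈[ suc n ] insert q m g
insert-cong {f = f} {g} {q} {m} f≈g q≤n {j} j<1+n with j ≟ q
... | yes refl = trans (insert-at q m f) (sym (insert-at q m g))
... | no j≢q   = trans (insert-≢ j≢q)
                   (trans (cong (punchIn m) (f≈g (punchOut< q≤n j≢q j<1+n))) (sym (insert-≢ j≢q)))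

delete-cong : ∀ {n F G q} → F ≈[ suc n ] G → q < suc n → delete q F ≈[ n ] delete q G
delete-cong {q = q} F≈G q<N i<n = cong₂ punchOut (F≈G q<N) (F≈G (punchIn<suc q i<n))

module Deletion {n F q} (F-inj : InjectiveBelow (suc n) F) (q<N : q < suc n) where

  value≢ : ∀ {x} → x < suc n → x ≢ q → F x ≢ F q
  value≢ x<N x≢q eq = x≢q (F-inj x<N q<N eq)

  deleted≢ : ∀ {i} → i < n → F (punchIn q i) ≢ F q
  deleted≢ {i} i<n = value≢ (punchIn<suc q i<n) (punchIn≢ q i)

  delete-bounded : BoundedBelow (suc n) F → BoundedBelow n (delete q F)
  delete-bounded F< i<n = punchOut< (s≤s⁻¹ (F< q<N)) (deleted≢ i<n) (F< (punchIn<suc q i<n))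

  delete-injective : InjectiveBelow n (delete q F)
  delete-injective i<n j<n eq = punchIn-injective q
    (F-inj (punchIn<suc q i<n) (punchIn<suc q j<n) (punchOut-injective (deleted≢ i<n) (deleted≢ j<n) eq))

  insert-delete : insert q (F q) (delete q F) ≈[ suc n ] F
  insert-delete {j} j<N with j ≟ q
  ... | yes refl = insert-at q (F q) (delete q F)
  ... | no j≢q   = begin
    insert q (F q) (delete q F) j
      ≡⟨ insert-≢ j≢q ⟩
    punchIn (F q) (punchOut (F q) (F (punchIn q (punchOut q j))))
      ≡⟨ cong (λ x → punchIn (F q) (punchOut (F q) (F x))) (punchIn-punchOut j≢q) ⟩
    punchIn (F q) (punchOut (F q) (F j))
      ≡⟨ punchIn-punchOut (value≢ j<N j≢q) ⟩
    F j ∎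
    where open ≡-Reasoning

  delete-reflects-Occ : ∀ {π} → Occ π n (delete q F) → Occ π (suc n) F
  delete-reflects-Occ {π} o@(occ i j k l i<j j<k k<l l<n ki il lj) =
    occ _ _ _ _ (punchIn-mono-< q i<j) (punchIn-mono-< q j<k) (punchIn-mono-< q k<l) (punchIn<suc q l<n)
        (⊏-reflect k<n i<n ki) (⊏-reflect i<n l<n il) (⊏-reflect l<n j<n lj)
    where
    open Occ o using (i<n; j<n; k<n)
    ⊏-reflect : ∀ {x y} → x < n → y < n → delete q F x ⊏[ π ] delete q F y →
                F (punchIn q x) ⊏[ π ] F (punchIn q y)
    ⊏-reflect x<n y<n = ⊏-punchOut⁻ π (deleted≢ x<n) (deleted≢ y<n)

  delete-preserves-Occ : ∀ {π} (o : Occ π (suc n) F) → Avoids o q → Occ π n (delete q F)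
  delete-preserves-Occ {π} o@(occ i j k l i<j j<k k<l l<N ki il lj) (i≢q , j≢q , k≢q , l≢q) =
    occ _ _ _ _ (punchOut-mono-< i≢q j≢q i<j) (punchOut-mono-< j≢q k≢q j<k) (punchOut-mono-< k≢q l≢q k<l)
        (punchOut< (s≤s⁻¹ q<N) l≢q l<N)
        (⊏-preserve k<N k≢q i<N i≢q ki) (⊏-preserve i<N i≢q l<N l≢q il)
        (⊏-preserve l<N l≢q j<N j≢q lj)
    where
    open Occ o renaming (i<n to i<N; j<n to j<N; k<n to k<N) using ()
    delete-punchOut : ∀ {x} → x ≢ q → delete q F (punchOut q x) ≡ punchOut (F q) (F x)
    delete-punchOut x≢q = cong (λ y → punchOut (F q) (F y)) (punchIn-punchOut x≢q)
    ⊏-preserve : ∀ {x y} → x < suc n → x ≢ q → y < suc n → y ≢ q → F x ⊏[ π ] F y →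
                 delete q F (punchOut q x) ⊏[ π ] delete q F (punchOut q y)
    ⊏-preserve x<N x≢q y<N y≢q =
      subst₂ (λ a b → a ⊏[ π ] b) (sym (delete-punchOut x≢q)) (sym (delete-punchOut y≢q))
      ∘ ⊏-punchOut π (value≢ x<N x≢q) (value≢ y<N y≢q)

delete-twins : ∀ {n F r} → InjectiveBelow (suc n) F → suc r < suc n → Adj (F r) (F (suc r)) →
               delete r F ≈[ n ] delete (suc r) F
delete-twins {n} {F} {r} F-inj 1+r<N adj {p} p<n with p ≟ r
... | yes refl = begin
  punchOut (F p) (F (punchIn p p))               ≡⟨ cong (punchOut (F p) ∘ F) (punchIn-≥ ≤-refl) ⟩
  punchOut (F p) (F (suc p))                     ≡⟨ punchOut-Adj-comm adj ⟩
  punchOut (F (suc p)) (F p)                     ≡⟨ cong (punchOut (F (suc p)) ∘ F) (punchIn-< (n<1+n p)) ⟨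
  punchOut (F (suc p)) (F (punchIn (suc p) p))   ∎
  where open ≡-Reasoning
... | no p≢r = begin
  punchOut (F r) (F (punchIn r p))   ≡⟨ cong (punchOut (F r) ∘ F) (punchIn-twins p≢r) ⟩
  punchOut (F r) (F x)               ≡⟨ punchOut-Adj-cong adj (x≢ r<N x≢r) (x≢ 1+r<N (punchIn≢ (suc r) p)) ⟩
  punchOut (F (suc r)) (F x)         ∎
  where
  open ≡-Reasoning
  x : ℕ
  x = punchIn (suc r) p
  r<N : r < suc n
  r<N = <-trans (n<1+n r) 1+r<N
  x≢r : x ≢ r
  x≢r = subst (_≢ r) (punchIn-twins p≢r) (punchIn≢ r p)
  x≢ : ∀ {y} → y < suc n → x ≢ y → F x ≢ F y
  x≢ y<N x≢y eq = x≢y (F-inj (punchIn<suc (suc r) p<n) y<N eq)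

delete-twin-preserves-Occ : ∀ {π n F r} → InjectiveBelow (suc n) F → suc r < suc n →
                            Adj (F r) (F (suc r)) → Occ π (suc n) F → Occ π n (delete (suc r) F)
delete-twin-preserves-Occ {r = r} F-inj 1+r<N adj o with twin-free adj o
... | inj₁ avoids-r  = Occ-cong (delete-twins F-inj 1+r<N adj)
                                (Deletion.delete-preserves-Occ F-inj (<-trans (n<1+n r) 1+r<N) o avoids-r)
... | inj₂ avoids-1+r = Deletion.delete-preserves-Occ F-inj 1+r<N o avoids-1+r

-- Runs of three consecutive values

data Run₃ (F : ℕ → ℕ) (r : ℕ) : Set where
  ascending  : suc (F r) ≡ F (suc r) → suc (F (suc r)) ≡ F (suc (suc r)) → Run₃ F r
  descending : suc (F (suc r)) ≡ F r → suc (F (suc (suc r))) ≡ F (suc r) → Run₃ F r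

run⇒Adj₁ : ∀ {F r} → Run₃ F r → Adj (F r) (F (suc r))
run⇒Adj₁ (ascending up _)    = inj₁ up
run⇒Adj₁ (descending down _) = inj₂ down

run⇒Adj₂ : ∀ {F r} → Run₃ F r → Adj (F (suc r)) (F (suc (suc r)))
run⇒Adj₂ (ascending _ up)    = inj₁ up
run⇒Adj₂ (descending _ down) = inj₂ down

Adj⇒run : ∀ {N F r} → InjectiveBelow N F → suc (suc r) < N →
          Adj (F r) (F (suc r)) → Adj (F (suc r)) (F (suc (suc r))) → Run₃ F r
Adj⇒run F-inj r+2<N (inj₁ up₁)   (inj₁ up₂)   = ascending up₁ up₂
Adj⇒run F-inj r+2<N (inj₂ down₁) (inj₂ down₂) = descending down₁ down₂
Adj⇒run {r = r} F-inj r+2<N (inj₁ up) (inj₂ down) =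
  contradiction (F-inj (<-trans r<r+2 r+2<N) r+2<N (suc-injective (trans up (sym down)))) (<⇒≢ r<r+2)
  where
  r<r+2 : r < suc (suc r)
  r<r+2 = m<n⇒m<1+n (n<1+n r)
Adj⇒run {r = r} F-inj r+2<N (inj₂ down) (inj₁ up) =
  contradiction (F-inj (<-trans r<r+2 r+2<N) r+2<N (trans (sym down) up)) (<⇒≢ r<r+2)
  where
  r<r+2 : r < suc (suc r)
  r<r+2 = m<n⇒m<1+n (n<1+n r)

run-neighbour : ∀ {N F r x} → InjectiveBelow N F → suc (suc r) < N → Run₃ F r → x < N →
                Adj (F x) (F (suc r)) → x ≡ r ⊎ x ≡ suc (suc r)
run-neighbour {N} {r = r} F-inj r+2<N run x<N adj with run | adj
... | ascending up₁ _ | inj₁ up = inj₁ (F-inj x<N r<N (suc-injective (trans up (sym up₁))))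
  where
  r<N : r < N
  r<N = <-trans (m<n⇒m<1+n (n<1+n r)) r+2<N
... | ascending _ up₂ | inj₂ down = inj₂ (F-inj x<N r+2<N (trans (sym down) up₂))
... | descending down₁ _ | inj₂ down = inj₁ (F-inj x<N r<N (trans (sym down) down₁))
  where
  r<N : r < N
  r<N = <-trans (m<n⇒m<1+n (n<1+n r)) r+2<N
... | descending _ down₂ | inj₁ up = inj₂ (F-inj x<N r+2<N (suc-injective (trans up (sym down₂))))

Run₃-up : ∀ {F r v} → F r ≡ v → F (suc r) ≡ suc v → F (suc (suc r)) ≡ suc (suc v) → Run₃ F r
Run₃-up refl e₁ e₂ = ascending (sym e₁) (trans (cong suc e₁) (sym e₂))

Run₃-down : ∀ {F r v} → F r ≡ suc (suc v) → F (suc r) ≡ suc v → F (suc (suc r)) ≡ v → Run₃ F r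
Run₃-down e₀ e₁ refl = descending (trans (cong suc e₁) (sym e₀)) (sym e₁)

insert-before : ∀ r m f → insert (suc r) m f r ≡ punchIn m (f r)
insert-before r m f = trans (cong (insert (suc r) m f) (sym (punchIn-< (n<1+n r)))) (insert-punchIn (suc r) m f r)

insert-after : ∀ r m f → insert (suc r) m f (suc (suc r)) ≡ punchIn m (f (suc r))
insert-after r m f =
  trans (cong (insert (suc r) m f) (sym (punchIn-≥ ≤-refl))) (insert-punchIn (suc r) m f (suc r))

insert-run : ∀ {f r} → Adj (f r) (f (suc r)) → Run₃ (insert (suc r) (f r ⊔ f (suc r)) f) r
insert-run {f} {r} (inj₁ up) =
  Run₃-up {insert (suc r) M f}
    (trans (insert-before r M f) (punchIn-< fr<M))
    (trans (insert-at (suc r) M f) (trans M≡ (sym up)))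
    (trans (insert-after r M f) (trans (punchIn-≥ (≤-reflexive M≡)) (cong suc (sym up))))
  where
  M : ℕ
  M = f r ⊔ f (suc r)
  M≡ : M ≡ f (suc r)
  M≡ = m≤n⇒m⊔n≡n (≤-trans (n≤1+n (f r)) (≤-reflexive up))
  fr<M : f r < M
  fr<M = subst (f r <_) (sym M≡) (≤-reflexive up)
insert-run {f} {r} (inj₂ down) =
  Run₃-down {insert (suc r) M f}
    (trans (insert-before r M f) (trans (punchIn-≥ (≤-reflexive M≡)) (cong suc (sym down))))
    (trans (insert-at (suc r) M f) (trans M≡ (sym down)))
    (trans (insert-after r M f) (punchIn-< fr+1<M))
  where
  M : ℕ
  M = f r ⊔ f (suc r)
  M≡ : M ≡ f r
  M≡ = m≥n⇒m⊔n≡m (≤-trans (n≤1+n (f (suc r))) (≤-reflexive down))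
  fr+1<M : f (suc r) < M
  fr+1<M = subst (f (suc r) <_) (sym M≡) (≤-reflexive down)

delete-middle-values : ∀ {F r} → Run₃ F r →
  let g = delete (suc r) F ; m = F (suc r) in
  (suc (g r) ≡ m × g (suc r) ≡ m) ⊎ (g r ≡ m × suc (g (suc r)) ≡ m)
delete-middle-values {F} {r} (ascending up₁ up₂) =
  inj₁ (trans (cong suc gr≡) up₁ , trans gr+1≡ (cong pred (sym up₂)))
  where
  gr≡ : delete (suc r) F r ≡ F r
  gr≡ = trans (cong (punchOut (F (suc r)) ∘ F) (punchIn-< (n<1+n r))) (punchOut-< (≤-reflexive up₁))
  gr+1≡ : delete (suc r) F (suc r) ≡ pred (F (suc (suc r)))
  gr+1≡ = trans (cong (punchOut (F (suc r)) ∘ F) (punchIn-≥ ≤-refl)) (punchOut-> (≤-reflexive up₂))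
delete-middle-values {F} {r} (descending down₁ down₂) =
  inj₂ (trans gr≡ (cong pred (sym down₁)) , trans (cong suc gr+1≡) down₂)
  where
  gr≡ : delete (suc r) F r ≡ pred (F r)
  gr≡ = trans (cong (punchOut (F (suc r)) ∘ F) (punchIn-< (n<1+n r))) (punchOut-> (≤-reflexive down₁))
  gr+1≡ : delete (suc r) F (suc r) ≡ F (suc (suc r))
  gr+1≡ = trans (cong (punchOut (F (suc r)) ∘ F) (punchIn-≥ ≤-refl)) (punchOut-< (≤-reflexive down₂))

delete-middle-Adj : ∀ {F r} → Run₃ F r → Adj (delete (suc r) F r) (delete (suc r) F (suc r))
delete-middle-Adj run with delete-middle-values run
... | inj₁ (up , eq)   = inj₁ (trans up (sym eq))
... | inj₂ (eq , down) = inj₂ (trans down (sym eq))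

delete-middle-⊔ : ∀ {F r} → Run₃ F r → delete (suc r) F r ⊔ delete (suc r) F (suc r) ≡ F (suc r)
delete-middle-⊔ run with delete-middle-values run
... | inj₁ (up , eq)   = trans (m≤n⇒m⊔n≡n (≤-trans (n≤1+n _) (≤-reflexive (trans up (sym eq))))) eq
... | inj₂ (eq , down) = trans (m≥n⇒m⊔n≡m (≤-trans (n≤1+n _) (≤-reflexive (trans down (sym eq))))) eq

module MiddleDeletion {n F r} (F-inj : InjectiveBelow (suc n) F) (r+2<N : suc (suc r) < suc n) (run : Run₃ F r)
  where

  q : ℕ
  q = suc r

  m : ℕ
  m = F q

  g : ℕ → ℕ
  g = delete q F

  q<N : q < suc n
  q<N = <-trans (n<1+n q) r+2<N

  q≤n : q ≤ n
  q≤n = s≤s⁻¹ q<N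

  r<n : r < n
  r<n = s≤s⁻¹ q<N

  open Deletion F-inj q<N using (value≢)

  no-straddle : ∀ {x} → suc x < suc n → ¬ (Adj (F x) m × Adj m (F (suc x)))
  no-straddle {x} 1+x<N (x~m , m~x+1)
    with run-neighbour F-inj r+2<N run (<-trans (n<1+n x) 1+x<N) x~m
       | run-neighbour F-inj r+2<N run 1+x<N (Adj-sym m~x+1)
  ... | inj₁ refl | inj₁ ()
  ... | inj₁ refl | inj₂ ()
  ... | inj₂ refl | inj₁ ()
  ... | inj₂ refl | inj₂ ()

  edge-delete : ∀ {i} → i ≢ r → Edge n g i ⇔ Edge (suc n) F (punchIn q i)
  edge-delete {i} i≢r = mk⇔
    (λ (1+i<n , adj) → let 1+x<N = subst (_< suc n) x+1≡ (punchIn<suc q 1+i<n) in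
                      1+x<N , Adj-punchOut⁻ (Fx≢m 1+x<N) (Fx+1≢m 1+x<N) (no-straddle 1+x<N) (adj-g⇒ adj))
    (λ (1+x<N , adj) → punchIn<suc⁻ q≤n (subst (_< suc n) (sym x+1≡) 1+x<N) ,
                      ⇒adj-g (Adj-punchOut⁺ (Fx≢m 1+x<N) (Fx+1≢m 1+x<N) adj))
    where
    x : ℕ
    x = punchIn q i
    x+1≡ : punchIn q (suc i) ≡ suc x
    x+1≡ = punchIn-suc (i≢r ∘ suc-injective)
    adj-g⇒ : Adj (g i) (g (suc i)) → Adj (punchOut m (F x)) (punchOut m (F (suc x)))
    adj-g⇒ = subst (λ y → Adj (g i) (punchOut m (F y))) x+1≡
    ⇒adj-g : Adj (punchOut m (F x)) (punchOut m (F (suc x))) → Adj (g i) (g (suc i))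
    ⇒adj-g = subst (λ y → Adj (g i) (punchOut m (F y))) (sym x+1≡)
    Fx≢m : suc x < suc n → F x ≢ m
    Fx≢m 1+x<N = value≢ (<-trans (n<1+n x) 1+x<N) (punchIn≢ q i)
    Fx+1≢m : suc x < suc n → F (suc x) ≢ m
    Fx+1≢m 1+x<N = value≢ 1+x<N (subst (_≢ q) x+1≡ (punchIn≢ q (suc i)))

  boxAt-delete : ∀ {i} → i < n → i ≢ r → i ≢ q → BoxAt n g i ⇔ BoxAt (suc n) F (punchIn q i)
  boxAt-delete {zero} _ 0≢r _ =
    ⇔-trans (boxAt-zero {f = g}) (⇔-trans (edge-delete 0≢r) (⇔-sym (boxAt-zero {f = F})))
  boxAt-delete {suc i} 1+i<n 1+i≢r 1+i≢q =
    ⇔-trans (boxAt-suc {f = g} 1+i<n)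
      (⇔-trans (edge-delete 1+i≢r ⊎-⇔ edge-delete (1+i≢q ∘ cong suc))
        (subst (λ y → (Edge (suc n) F y ⊎ Edge (suc n) F x) ⇔ BoxAt (suc n) F y) (sym x+1≡)
          (⇔-sym (boxAt-suc {f = F} (subst (_< suc n) x+1≡ (punchIn<suc q 1+i<n))))))
    where
    x : ℕ
    x = punchIn q i
    x+1≡ : punchIn q (suc i) ≡ suc x
    x+1≡ = punchIn-suc 1+i≢q

  boxAt-delete-below : ∀ {p} → p < r → BoxAt n g p ⇔ BoxAt (suc n) F p
  boxAt-delete-below {p} p<r =
    subst (λ y → BoxAt n g p ⇔ BoxAt (suc n) F y) (punchIn-< (m<n⇒m<1+n p<r))
      (boxAt-delete (<-trans p<r r<n) (<⇒≢ p<r) (<⇒≢ (m<n⇒m<1+n p<r)))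

  boxAt-g-r : BoxAt n g r
  boxAt-g-r = inj₁ (s≤s⁻¹ r+2<N , delete-middle-Adj run)

  boxAt-F-r : BoxAt (suc n) F r
  boxAt-F-r = inj₁ (q<N , run⇒Adj₁ run)

  boxCount-delete : count (boxAt? (suc n) F) (suc n) ≡ suc (count (boxAt? n g) n)
  boxCount-delete = begin
    count (boxAt? (suc n) F) (suc n)
      ≡⟨ count-punchIn (boxAt? (suc n) F) q n q≤n ⟩
    indicator (boxAt? (suc n) F q) + count (λ i → boxAt? (suc n) F (punchIn q i)) n
      ≡⟨ cong₂ _+_ (indicator-yes (boxAt? (suc n) F q) (inj₁ (r+2<N , run⇒Adj₂ run)))
                   (count-cong _ (boxAt? n g) n boxAt-correspondence) ⟩
    suc (count (boxAt? n g) n) ∎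
    where
    open ≡-Reasoning
    boxAt-correspondence : ∀ i → i < n → BoxAt (suc n) F (punchIn q i) ⇔ BoxAt n g i
    boxAt-correspondence i i<n with i ≟ r | i ≟ q
    ... | yes refl | _ =
      mk⇔ (λ _ → boxAt-g-r) (λ _ → subst (BoxAt (suc n) F) (sym (punchIn-< (n<1+n r))) boxAt-F-r)
    ... | _ | yes refl =
      mk⇔ (λ _ → inj₂ (z<s , delete-middle-Adj run))
          (λ _ → subst (BoxAt (suc n) F) (sym (punchIn-≥ ≤-refl)) (inj₂ (z<s , run⇒Adj₂ run)))
    ... | no i≢r | no i≢q = ⇔-sym (boxAt-delete i<n i≢r i≢q)

  least-delete : Least (BoxAt (suc n) F) (suc n) r ⇔ Least (BoxAt n g) n r
  least-delete = mk⇔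
    (λ (_ , _ , below) → r<n , boxAt-g-r ,
                         λ p p<r → below p p<r ∘ Equivalence.to (boxAt-delete-below p<r))
    (λ (_ , _ , below) → <-trans (n<1+n r) q<N , boxAt-F-r ,
                         λ p p<r → below p p<r ∘ Equivalence.from (boxAt-delete-below p<r))

punchIn-punchIn : ∀ {a p} → a ≤ p → punchIn a (punchIn a p) ≡ suc (suc p)
punchIn-punchIn {a} a≤p = trans (cong (punchIn a) (punchIn-≥ a≤p)) (punchIn-≥ (m≤n⇒m≤1+n a≤p))

-- The boxes other than a and a+1 are counted by R: exactly one remains, and an edge beyond a+1
-- other than (a+1, a+2) would make it two.
module _ {n f a} (three : count (boxAt? (suc (suc n)) f) (suc (suc n)) ≡ 3)
         (least : Least (BoxAt (suc (suc n)) f) (suc (suc n)) a) (a≤n : a ≤ n) where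
  private
    N : ℕ
    N = suc (suc n)

    P : ℕ → Set
    P = BoxAt N f

    R : ℕ → Set
    R x = P (punchIn a (punchIn a x))

    R? : ∀ x → Dec (R x)
    R? x = boxAt? N f (punchIn a (punchIn a x))

    beyond : ∀ {x} → a ≤ x → P (suc (suc x)) → R x
    beyond a≤x = subst P (sym (punchIn-punchIn a≤x))

    rest≡1 : count R? n ≡ 1
    rest≡1 = suc-injective (suc-injective (begin
      2 + count R? n
        ≡⟨ cong₂ _+_ (indicator-yes (boxAt? N f a) box-a)
                     (cong (_+ count R? n) (indicator-yes (boxAt? N f (punchIn a a)) box-a+1)) ⟨
      indicator (boxAt? N f a) + (indicator (boxAt? N f (punchIn a a)) + count R? n)
        ≡⟨ cong (indicator (boxAt? N f a) +_)
                (count-punchIn {P = P ∘ punchIn a} (λ x → boxAt? N f (punchIn a x)) a n a≤n) ⟨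
      indicator (boxAt? N f a) + count (λ x → boxAt? N f (punchIn a x)) (suc n)
        ≡⟨ count-punchIn {P = P} (boxAt? N f) a (suc n) (m≤n⇒m≤1+n a≤n) ⟨
      count (boxAt? N f) N
        ≡⟨ three ⟩
      3 ∎))
      where
      open ≡-Reasoning
      box-a : P a
      box-a = proj₁ (proj₂ least)
      box-a+1 : P (punchIn a a)
      box-a+1 = subst P (sym (punchIn-≥ ≤-refl)) (inj₂ (z<s , proj₂ (least-edge least)))

    third-box : ∃ λ p → a ≤ p × p < n × P (suc (suc p))
    third-box with least-exists {P = R} R? n (λ eq → 1+n≢n (trans (sym rest≡1) eq))
    ... | p , p<n , Rp , _ with a ≤? p
    ...   | yes a≤p = p , a≤p , p<n , subst P (punchIn-punchIn a≤p) Rp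
    ...   | no a≰p  =
      contradiction (subst P (punchIn-punchIn-< (≰⇒> a≰p)) Rp) (proj₂ (proj₂ least) p (≰⇒> a≰p))
      where
      punchIn-punchIn-< : ∀ {x} → x < a → punchIn a (punchIn a x) ≡ x
      punchIn-punchIn-< x<a = trans (cong (punchIn a) (punchIn-< x<a)) (punchIn-< x<a)

    two-boxes-beyond : ∀ {x} → a ≤ x → suc x < n → P (suc (suc x)) → P (suc (suc (suc x))) → ⊥
    two-boxes-beyond a≤x 1+x<n box₁ box₂ = <-irrefl refl (subst (1 <_) rest≡1
      (count-two {P = R} R? (beyond a≤x box₁) (beyond (m≤n⇒m≤1+n a≤x) box₂) (n<1+n _) 1+x<n))

    earlier-edge : ∀ {p} → a < p → p < n → Edge N f (suc p) → P (suc (suc p)) → ⊥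
    earlier-edge {suc p} (s≤s a≤p) p<n edge box = two-boxes-beyond a≤p p<n (inj₁ edge) box

  first-box-second-edge : Edge N f (suc a)
  first-box-second-edge with third-box
  ... | p , a≤p , p<n , box with Equivalence.to (boxAt-suc {f = f} (s<s (s<s p<n))) box | a ≟ p
  ...   | inj₁ (2+p<N , adj) | _       =
    ⊥-elim (two-boxes-beyond a≤p (s≤s⁻¹ (s≤s⁻¹ 2+p<N)) box (inj₂ (z<s , adj)))
  ...   | inj₂ edge          | yes refl = edge
  ...   | inj₂ edge          | no a≢p   = ⊥-elim (earlier-edge (≤∧≢⇒< a≤p a≢p) p<n edge box)

first-box-run : ∀ {N f a} → InjectiveBelow N f → count (boxAt? N f) N ≡ 3 → Least (BoxAt N f) N a →
                suc (suc a) < N × Run₃ f a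
first-box-run {zero}        _     _     least = contradiction (proj₁ (least-edge least)) λ ()
first-box-run {suc zero}    _     _     least = contradiction (proj₁ (least-edge least)) λ { (s≤s ()) }
first-box-run {suc (suc n)} f-inj three least =
  let (2+a<N , adj′) = first-box-second-edge three least (s≤s⁻¹ (s≤s⁻¹ (proj₁ (least-edge least))))
  in  2+a<N , Adj⇒run f-inj 2+a<N (proj₂ (least-edge least)) adj′

-- The bijection

record IsSepBox (n k : ℕ) (f : ℕ → ℕ) : Set where
  field
    injective : InjectiveBelow n f
    bounded   : BoundedBelow n f
    occFree   : ∀ π → ¬ Occ π n f
    boxes     : count (boxAt? n f) n ≡ k

module RemoveMiddle {n F a} (F-sb : IsSepBox (suc n) 3 F) (least : Least (BoxAt (suc n) F) (suc n) a) where
  open IsSepBox F-sb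

  a+2<N : suc (suc a) < suc n
  a+2<N = proj₁ (first-box-run injective boxes least)

  run : Run₃ F a
  run = proj₂ (first-box-run injective boxes least)

  open MiddleDeletion injective a+2<N run public using (g; q<N; boxCount-delete; least-delete)
  open Deletion injective q<N

  g-sb : IsSepBox n 2 g
  g-sb = record
    { injective = delete-injective
    ; bounded   = delete-bounded bounded
    ; occFree   = λ π → occFree π ∘ delete-reflects-Occ
    ; boxes     = suc-injective (trans (sym boxCount-delete) boxes)
    }

  g-least : Least (BoxAt n g) n a
  g-least = Equivalence.to least-delete least

  reinsert : insert (suc a) (g a ⊔ g (suc a)) g ≈[ suc n ] F
  reinsert {p} p<N = trans (cong (λ m → insert (suc a) m g p) (delete-middle-⊔ run)) (insert-delete p<N)

module InsertMiddle {n f a} (f-sb : IsSepBox n 2 f) (least : Least (BoxAt n f) n a) where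
  open IsSepBox f-sb

  M : ℕ
  M = f a ⊔ f (suc a)

  F : ℕ → ℕ
  F = insert (suc a) M f

  a+1<n : suc a < n
  a+1<n = proj₁ (least-edge least)

  F-inj : InjectiveBelow (suc n) F
  F-inj = insert-injective injective (<⇒≤ a+1<n)

  run : Run₃ F a
  run = insert-run (proj₂ (least-edge least))

  open MiddleDeletion F-inj (s<s a+1<n) run using (g; q<N; boxCount-delete; least-delete)

  g≈f : g ≈[ n ] f
  g≈f {p} _ = delete-insert (suc a) M f p

  F-sb : IsSepBox (suc n) 3 F
  F-sb = record
    { injective = F-inj
    ; bounded   = insert-bounded bounded (<⇒≤ a+1<n)
                    (<⇒≤ (⊔-lub (bounded (<-trans (n<1+n a) a+1<n)) (bounded a+1<n)))
    ; occFree   = λ π o → occFree π (Occ-cong g≈f (delete-twin-preserves-Occ F-inj q<N (run⇒Adj₁ run) o))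
    ; boxes     = trans boxCount-delete (cong suc (trans (boxCount-cong g≈f) boxes))
    }

  F-least : Least (BoxAt (suc n) F) (suc n) a
  F-least = Equivalence.from least-delete (Least-boxAt-cong (≈-sym g≈f) least)

deleteMiddle : ℕ → (ℕ → ℕ) → ℕ → ℕ
deleteMiddle N F = delete (suc (firstBox N F)) F

insertMiddle : ℕ → (ℕ → ℕ) → ℕ → ℕ
insertMiddle n f = let a = firstBox n f in insert (suc a) (f a ⊔ f (suc a)) f

deleteMiddle-at : ∀ {N F a} → firstBox N F ≡ a → deleteMiddle N F ≡ delete (suc a) F
deleteMiddle-at refl = refl

insertMiddle-at : ∀ {n f a} → firstBox n f ≡ a → insertMiddle n f ≡ insert (suc a) (f a ⊔ f (suc a)) f
insertMiddle-at refl = refl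

module _ {n F} (F-sb : IsSepBox (suc n) 3 F) where
  private
    first : ∃ (Least (BoxAt (suc n) F) (suc n))
    first = least-exists (boxAt? (suc n) F) (suc n)
              (λ eq → contradiction (trans (sym (IsSepBox.boxes F-sb)) eq) λ ())

    a : ℕ
    a = proj₁ first

    open RemoveMiddle F-sb (proj₂ first)

  deleteMiddle-IsSepBox : IsSepBox n 2 (deleteMiddle (suc n) F)
  deleteMiddle-IsSepBox =
    subst (IsSepBox n 2) (sym (deleteMiddle-at {suc n} {F} (firstBox-spec (proj₂ first)))) g-sb

  insertMiddle-deleteMiddle : ∀ {f} → f ≈[ n ] deleteMiddle (suc n) F → insertMiddle n f ≈[ suc n ] F
  insertMiddle-deleteMiddle {f} f≈ {p} p<N = begin
    insertMiddle n f p                     ≡⟨ cong-app (insertMiddle-at {n} {f} (firstBox-spec f-least)) p ⟩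
    insert (suc a) (f a ⊔ f (suc a)) f p   ≡⟨ cong (λ m → insert (suc a) m f p) (cong₂ _⊔_ (f≈g a<n) (f≈g a+1<n)) ⟩
    insert (suc a) (g a ⊔ g (suc a)) f p   ≡⟨ insert-cong f≈g (<⇒≤ a+1<n) p<N ⟩
    insert (suc a) (g a ⊔ g (suc a)) g p   ≡⟨ reinsert p<N ⟩
    F p                                    ∎
    where
    open ≡-Reasoning
    f≈g : f ≈[ n ] g
    f≈g = ≈-trans f≈ (λ {x} _ → cong-app (deleteMiddle-at {suc n} {F} (firstBox-spec (proj₂ first))) x)
    f-least : Least (BoxAt n f) n a
    f-least = Least-boxAt-cong (≈-sym f≈g) g-least
    a+1<n : suc a < n
    a+1<n = proj₁ (least-edge g-least)
    a<n : a < n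
    a<n = proj₁ g-least

module _ {n f} (f-sb : IsSepBox n 2 f) where
  private
    first : ∃ (Least (BoxAt n f) n)
    first = least-exists (boxAt? n f) n (λ eq → contradiction (trans (sym (IsSepBox.boxes f-sb)) eq) λ ())

    a : ℕ
    a = proj₁ first

    open InsertMiddle f-sb (proj₂ first)

  insertMiddle-IsSepBox : IsSepBox (suc n) 3 (insertMiddle n f)
  insertMiddle-IsSepBox =
    subst (IsSepBox (suc n) 3) (sym (insertMiddle-at {n} {f} (firstBox-spec (proj₂ first)))) F-sb

  deleteMiddle-insertMiddle : ∀ {G} → G ≈[ suc n ] insertMiddle n f → deleteMiddle (suc n) G ≈[ n ] f
  deleteMiddle-insertMiddle {G} G≈ {p} p<n = begin
    deleteMiddle (suc n) G p   ≡⟨ cong-app (deleteMiddle-at {suc n} {G} (firstBox-spec G-least)) p ⟩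
    delete (suc a) G p         ≡⟨ delete-cong G≈F (m<n⇒m<1+n a+1<n) p<n ⟩
    delete (suc a) F p         ≡⟨ delete-insert (suc a) M f p ⟩
    f p                        ∎
    where
    open ≡-Reasoning
    G≈F : G ≈[ suc n ] F
    G≈F = ≈-trans G≈ (λ {x} _ → cong-app (insertMiddle-at {n} {f} (firstBox-spec (proj₂ first))) x)
    G-least : Least (BoxAt (suc n) G) (suc n) a
    G-least = Least-boxAt-cong (≈-sym G≈F) F-least

toIsSepBox : ∀ {n k} {σ : Word n} → Unique σ → Separable σ → box σ ≡ k → IsSepBox n k (valℕ σ)
toIsSepBox {σ = σ} σ! sep b = record
  { injective = valℕ-injective σ!
  ; bounded   = valℕ-bounded σ
  ; occFree   = separable⇒occFree σ sep
  ; boxes     = trans (sym (box≡count σ)) b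
  }

fromIsSepBox : ∀ {n k} f → .(IsSepBox n k f) → SepBox n k
fromIsSepBox {n} f f-sb = sepBox (toWord n f (IsSepBox.bounded f-sb))
  (toWord-unique n f (IsSepBox.bounded f-sb) (IsSepBox.injective f-sb))
  (occFree⇒separable _ λ π → IsSepBox.occFree f-sb π ∘ Occ-cong (valℕ-toWord n f (IsSepBox.bounded f-sb)))
  (trans (box≡count (toWord n f (IsSepBox.bounded f-sb)))
         (trans (boxCount-cong (valℕ-toWord n f (IsSepBox.bounded f-sb))) (IsSepBox.boxes f-sb)))

valℕ-fromIsSepBox : ∀ {n k} f .(f-sb : IsSepBox n k f) → valℕ (SepBox.word (fromIsSepBox f f-sb)) ≈[ n ] f
valℕ-fromIsSepBox {n} f f-sb = valℕ-toWord n f (IsSepBox.bounded f-sb)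

SepBox-≡ : ∀ {n k} {x y : SepBox n k} → SepBox.word x ≡ SepBox.word y → x ≡ y
SepBox-≡ {x = sepBox _ _ _ _} {sepBox _ _ _ _} refl = refl

shrink : ∀ n → SepBox (suc n) 3 → SepBox n 2
shrink n (sepBox σ σ! sep b) =
  fromIsSepBox (deleteMiddle (suc n) (valℕ σ)) (deleteMiddle-IsSepBox (toIsSepBox σ! sep b))

grow : ∀ n → SepBox n 2 → SepBox (suc n) 3
grow n (sepBox σ σ! sep b) =
  fromIsSepBox (insertMiddle n (valℕ σ)) (insertMiddle-IsSepBox (toIsSepBox σ! sep b))

valℕ-shrink : ∀ n x → valℕ (SepBox.word (shrink n x)) ≈[ n ] deleteMiddle (suc n) (valℕ (SepBox.word x))
valℕ-shrink n (sepBox σ σ! sep b) =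
  valℕ-fromIsSepBox (deleteMiddle (suc n) (valℕ σ)) (deleteMiddle-IsSepBox (toIsSepBox σ! sep b))

valℕ-grow : ∀ n y → valℕ (SepBox.word (grow n y)) ≈[ suc n ] insertMiddle n (valℕ (SepBox.word y))
valℕ-grow n (sepBox σ σ! sep b) =
  valℕ-fromIsSepBox (insertMiddle n (valℕ σ)) (insertMiddle-IsSepBox (toIsSepBox σ! sep b))

shrink-grow : ∀ n y → shrink n (grow n y) ≡ y
shrink-grow n y@(sepBox σ σ! sep b) = SepBox-≡ (recompute (Vec.≡-dec Fin._≟_ _ σ) (word-≡
  (≈-trans (valℕ-shrink n (grow n y)) (deleteMiddle-insertMiddle (toIsSepBox σ! sep b) (valℕ-grow n y)))))

grow-shrink : ∀ n x → grow n (shrink n x) ≡ x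
grow-shrink n x@(sepBox σ σ! sep b) = SepBox-≡ (recompute (Vec.≡-dec Fin._≟_ _ σ) (word-≡
  (≈-trans (valℕ-grow n (shrink n x)) (insertMiddle-deleteMiddle (toIsSepBox σ! sep b) (valℕ-shrink n x)))))

theorem10 : (n : ℕ) → SepBox (suc n) 3 ⤖ SepBox n 2
theorem10 n = ↔⇒⤖ (mk↔ₛ′ (shrink n) (grow n) (shrink-grow n) (grow-shrink n))
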